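{- For all positive integers $n,k$ with $n\ge 3$, the cycle $C_n$ on $n$ vertices is a $k$-geometric mean graph.
   Context: Let $k$ be a positive integer. A finite simple graph $G$ with $p$ vertices and $q$ edges is a $k$-geometric mean graph if there is an injection $\psi: V(G)\to\{k,k+1,\dots,k+q\}$ such that, when each edge $uv$ is assigned one of the labels $\lfloor\sqrt{\psi(u)\psi(v)}\rfloor$ or $\lceil\sqrt{\psi(u)\psi(v)}\rceil$ (chosen per edge), the resulting set of edge labels is exactly $\{k,k+1,\dots,k+q-1\}$. -}

module Defs where

open import Data.Nat using (ℕ; zero; suc; _+_; _*_; _≤_; _<_)
open import Data.Nat.DivMod using (_%_; m%n<n)
open import Data.Fin using (Fin; toℕ; fromℕ<)
open import Data.Product using (Σ; _×_; _,_; proj₁; proj₂)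
open import Data.Sum using (_⊎_)
open import Relation.Binary.PropositionalEquality using (_≡_; _≢_)
open import Function.Definitions using (Injective)

record Graph : Set where
  field
    p    : ℕ
    q    : ℕ
    ends : Fin q → Fin p × Fin p

open Graph public

data SameEnds {p : ℕ} : Fin p × Fin p → Fin p × Fin p → Set where
  same : ∀ {u v} → SameEnds (u , v) (u , v)
  swap : ∀ {u v} → SameEnds (u , v) (v , u)

record IsSimple (G : Graph) : Set where
  field
    noLoop  : ∀ e → proj₁ (ends G e) ≢ proj₂ (ends G e)
    noMulti : ∀ e f → SameEnds (ends G e) (ends G f) → e ≡ f

-- The cycle C_n (n ≥ 1 to define; used with n ≥ 3): vertices 0..n-1,
-- edge i joins vertex i and vertex (i+1) mod n.
cycleGraph : ℕ → Graph
cycleGraph n = record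
  { p = n ; q = n
  ; ends = λ i → i , next i }
  where
  next : ∀ {m} → Fin m → Fin m
  next {suc m} i = fromℕ< (m%n<n (suc (toℕ i)) (suc m))

IsFloorSqrt : ℕ → ℕ → Set
IsFloorSqrt m l = (l * l ≤ m) × (m < suc l * suc l)

IsCeilSqrt : ℕ → ℕ → Set
IsCeilSqrt m l = (m ≤ l * l) × (∀ j → m ≤ j * j → l ≤ j)

record GeometricMeanLabeling (k : ℕ) (G : Graph) : Set where
  field
    ψ       : Fin (p G) → ℕ
    ψ-inj   : Injective _≡_ _≡_ ψ
    ψ-range : ∀ v → (k ≤ ψ v) × (ψ v ≤ k + q G)
    label   : Fin (q G) → ℕ
    label-ok : ∀ e →
      let m = ψ (proj₁ (ends G e)) * ψ (proj₂ (ends G e)) in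
      IsFloorSqrt m (label e) ⊎ IsCeilSqrt m (label e)
    label-range : ∀ e → (k ≤ label e) × (label e < k + q G)
    label-onto  : ∀ l → k ≤ l → l < k + q G → Σ (Fin (q G)) (λ e → label e ≡ l)

IsKGeometricMean : ℕ → Graph → Set
IsKGeometricMean k G = GeometricMeanLabeling k G

-- Write n = N + 1 and give vertex j (0 ≤ j ≤ N) the co-position i = N - j.
-- The labelling, written as offsets from k, climbs the even numbers, turns
-- at the summit value n and descends the odd numbers:
--   j < i            (rising):   vertex 2j,    edge to j+1 labelled 2j+1;
--   j = i, j = i+1   (summit):   vertex n,     edge labelled 2i;
--   j > i+1          (falling):  vertex 2i+1,  edge labelled 2i.
-- Consecutive vertex values then differ by 1, 2 or 3, and for a ≥ 1 the
-- edge label is ⌊√(a(a+1))⌋ = a, ⌈√(a(a+2))⌉ = a+1 or ⌊√(a(a+3))⌋ = a+1.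
module Submission where

open import Data.Nat using (ℕ; zero; suc; _+_; _*_; _∸_; _≤_; _<_; s≤s; z≤n)
open import Data.Nat.Properties
open import Data.Nat.DivMod using (_%_; m%n<n; n%n≡0; m<n⇒m%n≡m)
open import Data.Nat.Tactic.RingSolver using (solve-∀)
open import Data.Fin using (Fin; toℕ; fromℕ<)
open import Data.Fin.Properties using (toℕ-injective; toℕ<n; toℕ-fromℕ<)
open import Data.Product using (∃-syntax; _×_; _,_)
open import Data.Sum using (_⊎_; inj₁; inj₂)
open import Relation.Binary.PropositionalEquality
open import Relation.Binary.Definitions using (tri<; tri≈; tri>)
open import Relation.Nullary using (contradiction)
open import Defs

Admissible : ℕ → ℕ → ℕ → Set
Admissible x y l = IsFloorSqrt (x * y) l ⊎ IsCeilSqrt (x * y) l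

admissible-sym : ∀ x y {l} → Admissible x y l → Admissible y x l
admissible-sym x y {l} = subst (λ m → IsFloorSqrt m l ⊎ IsCeilSqrt m l) (*-comm x y)

floor-gap1 : ∀ a → IsFloorSqrt (a * suc a) a
floor-gap1 a = *-monoʳ-≤ a (n≤1+n a) , s≤s (m≤n+m (a * suc a) a)

-- ⌈√(a(a+2))⌉ = a+1 for a ≥ 1, since a² < a(a+2) < (a+1)².
ceil-gap2 : ∀ a → 1 ≤ a → IsCeilSqrt (a * (2 + a)) (suc a)
ceil-gap2 a a≥1 = subst (a * (2 + a) ≤_) (sym (square a)) (n≤1+n _) , least
  where
  square : ∀ a → suc a * suc a ≡ suc (a * (2 + a))
  square = solve-∀
  spread : ∀ a → a * a + (a + a) ≡ a * (2 + a)
  spread = solve-∀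
  least : ∀ j → a * (2 + a) ≤ j * j → suc a ≤ j
  least j bound = ≰⇒> λ j≤a → <⇒≱ (begin-strict
    j * j            ≤⟨ *-mono-≤ j≤a j≤a ⟩
    a * a            <⟨ m<m+n (a * a) (≤-trans a≥1 (m≤m+n a a)) ⟩
    a * a + (a + a)  ≡⟨ spread a ⟩
    a * (2 + a)      ∎) bound
    where open ≤-Reasoning

-- ⌊√(a(a+3))⌋ = a+1 for a ≥ 1, since (a+1)² ≤ a(a+3) < (a+2)².
floor-gap3 : ∀ a → 1 ≤ a → IsFloorSqrt (a * (3 + a)) (suc a)
floor-gap3 a a≥1 = ≤-pred (begin-strict
    suc a * suc a      <⟨ m<m+n (suc a * suc a) a≥1 ⟩
    suc a * suc a + a  ≡⟨ lower a ⟩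
    suc (a * (3 + a))  ∎)
  , subst (a * (3 + a) <_) (sym (upper a)) (m<m+n (a * (3 + a)) (s≤s z≤n))
  where
  open ≤-Reasoning
  lower : ∀ a → suc a * suc a + a ≡ suc (a * (3 + a))
  lower = solve-∀
  upper : ∀ a → suc (suc a) * suc (suc a) ≡ a * (3 + a) + (4 + a)
  upper = solve-∀

ascend2 : ∀ {k j} → 1 ≤ k →
          Admissible (k + (j + j)) (k + (suc j + suc j)) (k + suc (j + j))
ascend2 {k} {j} k≥1 =
  subst₂ (Admissible a) (shift k j) (sym (+-suc k (j + j)))
         (inj₂ (ceil-gap2 a (≤-trans k≥1 (m≤m+n k (j + j)))))
  where
  a = k + (j + j)
  shift : ∀ k j → 2 + (k + (j + j)) ≡ k + (suc j + suc j)
  shift = solve-∀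

ascend3 : ∀ {k j} → 1 ≤ k →
          Admissible (k + (j + j)) (k + suc (suc j + suc j)) (k + suc (j + j))
ascend3 {k} {j} k≥1 =
  subst₂ (Admissible a) (shift k j) (sym (+-suc k (j + j)))
         (inj₁ (floor-gap3 a (≤-trans k≥1 (m≤m+n k (j + j)))))
  where
  a = k + (j + j)
  shift : ∀ k j → 3 + (k + (j + j)) ≡ k + suc (suc j + suc j)
  shift = solve-∀

descend2 : ∀ {k i} →
           Admissible (k + suc (suc i + suc i)) (k + suc (i + i)) (k + (suc i + suc i))
descend2 {k} {i} =
  subst₂ (λ x l → Admissible x a l) (shift k i) (label-eq k i)
         (admissible-sym a (2 + a) (inj₂ (ceil-gap2 a (≤-trans (s≤s z≤n) (m≤n+m (suc (i + i)) k)))))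
  where
  a = k + suc (i + i)
  shift : ∀ k i → 2 + (k + suc (i + i)) ≡ k + suc (suc i + suc i)
  shift = solve-∀
  label-eq : ∀ k i → suc (k + suc (i + i)) ≡ k + (suc i + suc i)
  label-eq = solve-∀

descend3 : ∀ {k i} →
           Admissible (k + (suc (suc i) + suc (suc i))) (k + suc (i + i)) (k + (suc i + suc i))
descend3 {k} {i} =
  subst₂ (λ x l → Admissible x a l) (shift k i) (label-eq k i)
         (admissible-sym a (3 + a) (inj₁ (floor-gap3 a (≤-trans (s≤s z≤n) (m≤n+m (suc (i + i)) k)))))
  where
  a = k + suc (i + i)
  shift : ∀ k i → 3 + (k + suc (i + i)) ≡ k + (suc (suc i) + suc (suc i))
  shift = solve-∀
  label-eq : ∀ k i → suc (k + suc (i + i)) ≡ k + (suc i + suc i)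
  label-eq = solve-∀

descend1 : ∀ {k} → Admissible (k + 1) (k + 0) (k + 0)
descend1 {k} = subst (λ x → Admissible x (k + 0) (k + 0)) (sym (+-suc k 0))
  (admissible-sym (k + 0) (suc (k + 0)) (inj₁ (floor-gap1 (k + 0))))

-- The zone of a position j with co-position i (so the cycle has j + i + 1
-- vertices); the summit is the single middle vertex (odd cycle) or the
-- upper of the two middle vertices (even cycle).
data Zone : ℕ → ℕ → Set where
  rising  : ∀ {j i} → j < i → Zone j i
  middle  : ∀ {i} → Zone i i
  peak    : ∀ {i} → Zone (suc i) i
  falling : ∀ {j i} → suc i < j → Zone j i

zone : ∀ j i → Zone j i
zone j i with <-cmp j i
... | tri< j<i _ _ = rising j<i
... | tri≈ _ refl _ = middle
... | tri> _ _ i<j with m≤n⇒m<n∨m≡n i<j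
...   | inj₁ 1+i<j = falling 1+i<j
...   | inj₂ refl = peak

-- Offset of the vertex value in each zone (the summit carries j + i + 1).
valueAt : ∀ {j i} → Zone j i → ℕ
valueAt {j = j} (rising _) = j + j
valueAt {i = i} middle = suc (i + i)
valueAt {i = i} peak = suc i + suc i
valueAt {i = i} (falling _) = suc (i + i)

labelAt : ∀ {j i} → Zone j i → ℕ
labelAt {j = j} (rising _) = suc (j + j)
labelAt {i = i} middle = i + i
labelAt {i = i} peak = i + i
labelAt {i = i} (falling _) = i + i

value : ℕ → ℕ → ℕ
value j i = valueAt (zone j i)

label : ℕ → ℕ → ℕ
label j i = labelAt (zone j i)

valueAt-bound : ∀ {j i} (z : Zone j i) → valueAt z ≤ suc (j + i)
valueAt-bound {j} (rising j<i) = m≤n⇒m≤1+n (+-monoʳ-≤ j (<⇒≤ j<i))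
valueAt-bound middle = ≤-refl
valueAt-bound {i = i} peak = ≤-reflexive (cong suc (+-suc i i))
valueAt-bound {i = i} (falling 1+i<j) = s≤s (+-monoˡ-≤ i (<⇒≤ (<⇒≤ 1+i<j)))

labelAt-bound : ∀ {j i} (z : Zone j i) → labelAt z < suc (j + i)
labelAt-bound {j} (rising j<i) = s≤s (+-monoʳ-< j j<i)
labelAt-bound {i = i} middle = s≤s (+-monoˡ-≤ i ≤-refl)
labelAt-bound {i = i} peak = s≤s (+-monoˡ-≤ i (n≤1+n i))
labelAt-bound {i = i} (falling 1+i<j) = s≤s (+-monoˡ-≤ i (<⇒≤ (<⇒≤ 1+i<j)))

valueAt-parity : ∀ {j i} (z : Zone j i) → valueAt z ≡ j + j ⊎ valueAt z ≡ suc (i + i)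
valueAt-parity (rising _) = inj₁ refl
valueAt-parity middle = inj₂ refl
valueAt-parity peak = inj₁ refl
valueAt-parity (falling _) = inj₂ refl

double : ∀ m → m + m ≡ 2 * m
double m = cong (m +_) (sym (+-identityʳ m))

double-injective : ∀ {a b} → a + a ≡ b + b → a ≡ b
double-injective {a} {b} eq = *-cancelˡ-≡ a b 2 (trans (sym (double a)) (trans eq (double b)))

double≢odd : ∀ a b → a + a ≢ suc (b + b)
double≢odd a b eq = even≢odd a b (trans (sym (double a)) (trans eq (cong suc (double b))))

value-injective : ∀ {j i j′ i′} → j + i ≡ j′ + i′ → value j i ≡ value j′ i′ → j ≡ j′
value-injective {j} {i} {j′} {i′} sum eq
  with valueAt-parity (zone j i) | valueAt-parity (zone j′ i′)
... | inj₁ even | inj₁ even′ = double-injective (trans (sym even) (trans eq even′))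
... | inj₁ even | inj₂ odd′ = contradiction (trans (sym even) (trans eq odd′)) (double≢odd j i′)
... | inj₂ odd | inj₁ even′ = contradiction (trans (sym even′) (trans (sym eq) odd)) (double≢odd j′ i)
... | inj₂ odd | inj₂ odd′ = +-cancelʳ-≡ i j j′ (trans sum (cong (j′ +_) (sym same-i)))
  where
  same-i : i ≡ i′
  same-i = double-injective (suc-injective (trans (sym odd) (trans eq odd′)))

labelAt-rising : ∀ {j i} (z : Zone j i) → j < i → labelAt z ≡ suc (j + j)
labelAt-rising (rising _) _ = refl
labelAt-rising middle i<i = contradiction i<i (n≮n _)
labelAt-rising {i = i} peak 1+i<i = contradiction 1+i<i (<-asym (n<1+n i))
labelAt-rising {i = i} (falling 1+i<j) j<i = contradiction 1+i<j (<-asym (<-trans j<i (n<1+n i)))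

labelAt-descending : ∀ {j i} (z : Zone j i) → i ≤ j → labelAt z ≡ i + i
labelAt-descending (rising j<i) i≤j = contradiction i≤j (<⇒≱ j<i)
labelAt-descending middle _ = refl
labelAt-descending peak _ = refl
labelAt-descending (falling _) _ = refl

even-or-odd : ∀ t → ∃[ h ] (t ≡ h + h ⊎ t ≡ suc (h + h))
even-or-odd zero = 0 , inj₁ refl
even-or-odd (suc t) with even-or-odd t
... | h , inj₁ refl = h , inj₂ refl
... | h , inj₂ refl = suc h , inj₁ (cong suc (sym (+-suc h h)))

-- Every t ≤ N labels the edge leaving some position of the cycle with
-- N + 1 vertices: t = 2h + 1 leaves rising position h, and t = 2h leaves
-- the descending position with co-position h.
label-surjective : ∀ {N t} → t ≤ N → ∃[ j ] ∃[ i ] (j + i ≡ N × label j i ≡ t)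
label-surjective {t = t} t≤N with even-or-odd t | m≤n⇒∃[o]m+o≡n t≤N
... | h , inj₁ refl | r , sum =
  h + r , h , trans (rearrange h r) sum , labelAt-descending (zone (h + r) h) (m≤m+n h r)
  where
  rearrange : ∀ h r → h + r + h ≡ h + h + r
  rearrange = solve-∀
... | h , inj₂ refl | r , sum =
  h , suc (h + r) , trans (rearrange h r) sum , labelAt-rising (zone h (suc (h + r))) (s≤s (m≤m+n h r))
  where
  rearrange : ∀ h r → h + suc (h + r) ≡ suc (h + h + r)
  rearrange = solve-∀

-- The edge from position j to position j + 1 (co-positions i + 1 and i):
-- rising stays rising or reaches the summit, the summit and falling zones
-- lead to the falling zone.
step-edge : ∀ {k} → 1 ≤ k → ∀ j i →
            Admissible (k + value j (suc i)) (k + value (suc j) i) (k + label j (suc i))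
step-edge {k} k≥1 j i = edgeAt (zone j (suc i)) (zone (suc j) i)
  where
  edgeAt : ∀ {j i} (z : Zone j (suc i)) (z′ : Zone (suc j) i) →
           Admissible (k + valueAt z) (k + valueAt z′) (k + labelAt z)
  edgeAt (rising _) (rising _) = ascend2 k≥1
  edgeAt (rising _) peak = ascend2 k≥1
  edgeAt (rising _) middle = ascend3 k≥1
  edgeAt middle (falling _) = descend2
  edgeAt peak (falling _) = descend3
  edgeAt (falling _) (falling _) = descend2
  -- The remaining combinations would put position j + 1 before position j.
  edgeAt (rising j<1+i) (falling 1+i<1+j) = contradiction (≤-pred j<1+i) (<⇒≱ (≤-pred 1+i<1+j))
  edgeAt middle (rising 2+i<i) = contradiction (m≤n+m _ 2) (<⇒≱ 2+i<i)
  edgeAt peak (rising 3+i<i) = contradiction (m≤n+m _ 3) (<⇒≱ 3+i<i)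
  edgeAt (falling 2+i<j) (rising 1+j<i) =
    contradiction (m≤n+m _ 2) (<⇒≱ (<-trans 2+i<j (<-trans (n<1+n _) 1+j<i)))
  edgeAt (falling 3+j<j) middle = contradiction (m≤n+m _ 3) (<⇒≱ 3+j<j)
  edgeAt (falling 2+i<i) peak = contradiction (m≤n+m _ 2) (<⇒≱ 2+i<i)

-- The closing edge from position N (co-position 0) to position 0; it is
-- falling into rising once the cycle has at least three vertices.
wrap-edge : ∀ {k j} → 2 ≤ j →
            Admissible (k + value j 0) (k + value 0 j) (k + label j 0)
wrap-edge {k} {j} 2≤j = edgeAt (zone j 0) (zone 0 j) 2≤j
  where
  edgeAt : ∀ {j} (z : Zone j 0) (z′ : Zone 0 j) → 2 ≤ j →
           Admissible (k + valueAt z) (k + valueAt z′) (k + labelAt z)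
  edgeAt (falling _) (rising _) _ = descend1
  edgeAt middle _ ()
  edgeAt peak _ (s≤s ())

co-position : ∀ {N j} → j ≤ N → j + (N ∸ j) ≡ N
co-position = m+[n∸m]≡n

co-position-unique : ∀ {N j i} → j + i ≡ N → N ∸ j ≡ i
co-position-unique {j = j} {i} refl = m+n∸m≡n j i

value-bound : ∀ {N j} → j ≤ N → value j (N ∸ j) ≤ suc N
value-bound {N} {j} j≤N =
  subst (λ s → value j (N ∸ j) ≤ suc s) (co-position j≤N) (valueAt-bound (zone j (N ∸ j)))

label-bound : ∀ {N j} → j ≤ N → label j (N ∸ j) < suc N
label-bound {N} {j} j≤N =
  subst (λ s → label j (N ∸ j) < suc s) (co-position j≤N) (labelAt-bound (zone j (N ∸ j)))

cycle-edge : ∀ {N k} → 2 ≤ N → 1 ≤ k → ∀ j → j ≤ N →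
             Admissible (k + value j (N ∸ j))
                        (k + value (suc j % suc N) (N ∸ (suc j % suc N)))
                        (k + label j (N ∸ j))
cycle-edge {N} {k} 2≤N k≥1 j j≤N with m≤n⇒m<n∨m≡n j≤N
... | inj₁ j<N =
  subst₂ (λ c s → Admissible (k + value j c) (k + value s (N ∸ s)) (k + label j c))
         (sym (+-∸-assoc 1 j<N)) (sym (m<n⇒m%n≡m (s≤s j<N)))
         (step-edge k≥1 j (N ∸ suc j))
... | inj₂ refl =
  subst₂ (λ c s → Admissible (k + value N c) (k + value s (N ∸ s)) (k + label N c))
         (sym (n∸n≡0 N)) (sym (n%n≡0 (suc N)))
         (wrap-edge 2≤N)

cycleLabeling : ∀ N k → 2 ≤ N → 1 ≤ k → GeometricMeanLabeling k (cycleGraph (suc N))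
cycleLabeling N k 2≤N k≥1 = record
  { ψ = λ v → k + value (toℕ v) (N ∸ toℕ v)
  ; ψ-inj = λ {v} {w} eq → toℕ-injective
      (value-injective (trans (co-position (position v)) (sym (co-position (position w))))
                       (+-cancelˡ-≡ k _ _ eq))
  ; ψ-range = λ v → m≤m+n k _ , +-monoʳ-≤ k (value-bound (position v))
  ; label = λ e → k + label (toℕ e) (N ∸ toℕ e)
  ; label-ok = λ e → subst (λ j → Admissible (k + value (toℕ e) (N ∸ toℕ e))
                                               (k + value j (N ∸ j))
                                               (k + label (toℕ e) (N ∸ toℕ e)))
                           (sym (toℕ-fromℕ< (m%n<n (suc (toℕ e)) (suc N))))
                           (cycle-edge 2≤N k≥1 (toℕ e) (position e))
  ; label-range = λ e → m≤m+n k _ , +-monoʳ-< k (label-bound (position e))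
  ; label-onto = onto
  }
  where
  position : (v : Fin (suc N)) → toℕ v ≤ N
  position v = ≤-pred (toℕ<n v)

  onto : ∀ l → k ≤ l → l < k + suc N → ∃[ e ] k + label (toℕ e) (N ∸ toℕ e) ≡ l
  onto l k≤l l<k+n with m≤n⇒∃[o]m+o≡n k≤l
  ... | t , refl with label-surjective (≤-pred (+-cancelˡ-< k t (suc N) l<k+n))
  ... | j , i , sum , labelled = fromℕ< j<n , cong (k +_) (begin
    label (toℕ (fromℕ< j<n)) (N ∸ toℕ (fromℕ< j<n))  ≡⟨ cong (λ x → label x (N ∸ x)) (toℕ-fromℕ< j<n) ⟩
    label j (N ∸ j)                                  ≡⟨ cong (label j) (co-position-unique sum) ⟩
    label j i                                        ≡⟨ labelled ⟩
    t                                                ∎)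
    where
    open ≡-Reasoning
    j<n : j < suc N
    j<n = s≤s (subst (j ≤_) sum (m≤m+n j i))

mainTheorem5 : (n k : ℕ) → 3 ≤ n → 1 ≤ k → IsKGeometricMean k (cycleGraph n)
mainTheorem5 (suc N) k (s≤s 2≤N) k≥1 = cycleLabeling N k 2≤N k≥1
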